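{- For all sufficiently large $n$, if $A\subseteq[2,n]$ has size at least $n-\tfrac12\sqrt{n}$, then there are at least $\tfrac18 n$ solutions in $A$ to $ab=c$, i.e. at least $n/8$ triples $(a,b,c)\in A^3$ with $ab=c$.
   Context: $[2,n]=\{2,\dots,n\}$. -}

module Defs where

open import Data.Nat using (ℕ; suc; _*_; _≟_)
open import Data.Fin using (Fin; toℕ)
open import Data.Fin.Subset using (Subset)
open import Data.Fin.Subset.Properties using (_∈?_)
open import Data.List using (List; filter; cartesianProduct; length; allFin)
open import Data.Product using (_×_; _,_)
open import Relation.Nullary.Decidable using (_×-dec_)

-- A subset of {0,…,n} is represented by  A : Subset (suc n)  (element i ↔ number toℕ i).

triples : (n : ℕ) → List (Fin (suc n) × Fin (suc n) × Fin (suc n))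
triples n = cartesianProduct (allFin (suc n)) (cartesianProduct (allFin (suc n)) (allFin (suc n)))

solutions : {n : ℕ} → Subset (suc n) → List (Fin (suc n) × Fin (suc n) × Fin (suc n))
solutions {n} A =
  filter (λ { (a , b , c) → (a ∈? A) ×-dec ((b ∈? A) ×-dec ((c ∈? A) ×-dec (toℕ a * toℕ b ≟ toℕ c))) })
         (triples n)

#solutions : {n : ℕ} → Subset (suc n) → ℕ
#solutions A = length (solutions A)

-- Let K ≥ n − |A|, so at most K + 1 points of [0, n] miss A. For a ≥ 1 and m = ⌊n/a⌋,
-- at most K + 1 of the b ≤ m miss A, and since b ↦ ab is injective into [0, n], at most
-- K + 1 of the ab miss A; so a has at least m − (2K + 1) partners b with b, ab ∈ A.
-- At most K + 1 points of [0, 2K] miss A and these lower bounds decrease in a, so the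
-- elements of A in [0, 2K] alone give at least ∑_{a = K+1}^{2K} (⌊n/a⌋ − 2K − 1) solutions,
-- which by a tangent-line estimate is at least 2nK/(3K + 1) − 2K(K + 1) ≥ n/8 once
-- 4K² ≤ n and K ≥ 18.
module Submission where

open import Defs
open import Data.Nat using (ℕ; suc; _*_; _∸_; _≤_; _^_)
open import Data.Fin using (toℕ)
open import Data.Fin.Subset using (Subset; _∈_; ∣_∣)
open import Data.Product using (∃-syntax)

open import Data.Bool using (Bool; true; false; _∧_; not)
open import Data.Fin using (Fin; zero; suc)
open import Data.Fin.Subset.Properties using (_∈?_)
open import Data.List using ([]; _∷_; _++_; filter; cartesianProduct; length; allFin; tabulate; map)
open import Data.List.Properties using (filter-++; length-++; filter-some)
open import Data.List.Membership.Propositional.Properties using (∈-allFin)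
import Data.List.Relation.Unary.Any as Any
open import Data.Nat using (zero; _+_; _≟_; _<_; _⊔_; _≤?_; _≤′_; ≤′-refl; ≤′-step; z≤n; s≤s; s≤s⁻¹; NonZero)
open import Data.Nat.DivMod using (_/_; _%_; m≡m%n+[m/n]*n; m%n<n; m/n*n≤m; m/n≤m; /-monoʳ-≤)
open import Data.Nat.Properties
open import Data.Nat.Tactic.RingSolver using (solve-∀)
open import Data.Product using (_×_; _,_)
open import Data.Sum using (inj₁; inj₂)
open import Data.Vec.Base using ([]; _∷_; here; there)
open import Level using (Level)
open import Relation.Binary.PropositionalEquality
open import Relation.Nullary using (Dec; yes; no; does)
open import Relation.Nullary.Decidable using (_×-dec_)
open import Relation.Unary using (Pred; Decidable)

∑ : ℕ → (ℕ → ℕ) → ℕ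
∑ zero    f = 0
∑ (suc m) f = ∑ m f + f m

syntax ∑ m (λ i → f) = ∑[ i < m ] f

module _ {f g : ℕ → ℕ} where

  ∑-cong : ∀ m → (∀ i → f i ≡ g i) → ∑ m f ≡ ∑ m g
  ∑-cong zero    f≡g = refl
  ∑-cong (suc m) f≡g = cong₂ _+_ (∑-cong m f≡g) (f≡g m)

  ∑-mono-≤ : ∀ m → (∀ i → i < m → f i ≤ g i) → ∑ m f ≤ ∑ m g
  ∑-mono-≤ zero    f≤g = z≤n
  ∑-mono-≤ (suc m) f≤g = +-mono-≤ (∑-mono-≤ m (λ i i<m → f≤g i (m<n⇒m<1+n i<m))) (f≤g m ≤-refl)

  ∑-distrib-+ : ∀ m → ∑[ i < m ] (f i + g i) ≡ ∑ m f + ∑ m g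
  ∑-distrib-+ zero    = refl
  ∑-distrib-+ (suc m) = trans (cong (_+ (f m + g m)) (∑-distrib-+ m)) (+-assoc-comm (∑ m f) (∑ m g) (f m) (g m))
    where
    +-assoc-comm : ∀ a b c d → a + b + (c + d) ≡ a + c + (b + d)
    +-assoc-comm = solve-∀

∑-const : ∀ m c → ∑[ i < m ] c ≡ m * c
∑-const zero    c = refl
∑-const (suc m) c = trans (cong (_+ c) (∑-const m c)) (+-comm (m * c) c)

*-distribˡ-∑ : ∀ c m (f : ℕ → ℕ) → ∑[ i < m ] (c * f i) ≡ c * ∑ m f
*-distribˡ-∑ c zero    f = sym (*-zeroʳ c)
*-distribˡ-∑ c (suc m) f = trans (cong (_+ c * f m) (*-distribˡ-∑ c m f)) (sym (*-distribˡ-+ c (∑ m f) (f m)))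

∑-head : ∀ m (f : ℕ → ℕ) → ∑ (suc m) f ≡ f 0 + ∑[ i < m ] f (suc i)
∑-head zero    f = +-comm 0 (f 0)
∑-head (suc m) f = trans (cong (_+ f (suc m)) (∑-head m f)) (+-assoc (f 0) _ _)

∑-mono-≤′-length : ∀ (f : ℕ → ℕ) {m m′} → m ≤′ m′ → ∑ m f ≤ ∑ m′ f
∑-mono-≤′-length f ≤′-refl        = ≤-refl
∑-mono-≤′-length f (≤′-step m≤m′) = ≤-trans (∑-mono-≤′-length f m≤m′) (m≤m+n _ _)

∑-mono-length : ∀ (f : ℕ → ℕ) {m m′} → m ≤ m′ → ∑ m f ≤ ∑ m′ f
∑-mono-length f m≤m′ = ∑-mono-≤′-length f (≤⇒≤′ m≤m′)

∑≤∑∸+ : ∀ m c (f : ℕ → ℕ) → ∑ m f ≤ ∑[ i < m ] (f i ∸ c) + m * c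
∑≤∑∸+ m c f = begin
  ∑ m f                                ≤⟨ ∑-mono-≤ m (λ i _ → m≤n+m∸n (f i) c) ⟩
  ∑[ i < m ] (c + (f i ∸ c))           ≡⟨ ∑-distrib-+ m ⟩
  ∑[ i < m ] c + ∑[ i < m ] (f i ∸ c)  ≡⟨ cong (_+ ∑[ i < m ] (f i ∸ c)) (∑-const m c) ⟩
  m * c + ∑[ i < m ] (f i ∸ c)         ≡⟨ +-comm (m * c) _ ⟩
  ∑[ i < m ] (f i ∸ c) + m * c         ∎
  where open ≤-Reasoning

∑-dilate : ∀ a m (g : ℕ → ℕ) → ∑[ b < suc m ] g (suc a * b) ≤ ∑[ j < suc (suc a * m) ] g j
∑-dilate a zero    g rewrite *-zeroʳ a = ≤-refl
∑-dilate a (suc m) g = begin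
  ∑[ b < suc m ] g (suc a * b) + g (suc a * suc m)  ≤⟨ +-monoˡ-≤ _ (∑-dilate a m g) ⟩
  ∑[ j < suc (suc a * m) ] g j + g (suc a * suc m)  ≡⟨ cong (λ k → ∑[ j < suc (suc a * m) ] g j + g k) step ⟩
  ∑[ j < suc (suc a * m) ] g j + g (suc (suc a * m) + a)
    ≤⟨ +-monoˡ-≤ (g (suc (suc a * m) + a)) (∑-mono-length g (m≤m+n (suc (suc a * m)) a)) ⟩
  ∑[ j < suc (suc (suc a * m) + a) ] g j            ≡⟨ cong (λ k → ∑[ j < suc k ] g j) (sym step) ⟩
  ∑[ j < suc (suc a * suc m) ] g j                  ∎
  where
  open ≤-Reasoning
  step : suc a * suc m ≡ suc (suc a * m) + a
  step = lemma a m
    where lemma : ∀ a m → (1 + a) * (1 + m) ≡ 1 + (1 + a) * m + a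
          lemma = solve-∀

𝟙 : Bool → ℕ
𝟙 true  = 1
𝟙 false = 0

missing : (ℕ → Bool) → ℕ → ℕ
missing x m = ∑[ i < m ] 𝟙 (not (x i))

count+missing≡length : ∀ (x : ℕ → Bool) m → ∑[ i < m ] 𝟙 (x i) + missing x m ≡ m
count+missing≡length x m = begin
  ∑[ i < m ] 𝟙 (x i) + missing x m   ≡⟨ ∑-distrib-+ m ⟨
  ∑[ i < m ] (𝟙 (x i) + 𝟙 (not (x i))) ≡⟨ ∑-cong m (λ i → 𝟙+𝟙-not (x i)) ⟩
  ∑[ i < m ] 1                       ≡⟨ ∑-const m 1 ⟩
  m * 1                              ≡⟨ *-identityʳ m ⟩
  m                                  ∎
  where
  open ≡-Reasoning
  𝟙+𝟙-not : ∀ u → 𝟙 u + 𝟙 (not u) ≡ 1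
  𝟙+𝟙-not true  = refl
  𝟙+𝟙-not false = refl

length≤common+missing+missing : ∀ (x y : ℕ → Bool) m →
  m ≤ ∑[ i < m ] 𝟙 (x i ∧ y i) + missing x m + missing y m
length≤common+missing+missing x y m = begin
  m                                   ≡⟨ *-identityʳ m ⟨
  m * 1                               ≡⟨ ∑-const m 1 ⟨
  ∑[ i < m ] 1                        ≤⟨ ∑-mono-≤ m (λ i _ → covered (x i) (y i)) ⟩
  ∑[ i < m ] (𝟙 (x i ∧ y i) + 𝟙 (not (x i)) + 𝟙 (not (y i)))
    ≡⟨ ∑-distrib-+ m ⟩
  ∑[ i < m ] (𝟙 (x i ∧ y i) + 𝟙 (not (x i))) + missing y m
    ≡⟨ cong (_+ missing y m) (∑-distrib-+ m) ⟩
  ∑[ i < m ] 𝟙 (x i ∧ y i) + missing x m + missing y m ∎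
  where
  open ≤-Reasoning
  covered : ∀ u v → 1 ≤ 𝟙 (u ∧ v) + 𝟙 (not u) + 𝟙 (not v)
  covered true  true  = ≤-refl
  covered true  false = ≤-refl
  covered false v     = s≤s z≤n

module _ (w : ℕ → ℕ) (w-antitone : ∀ i → w (suc i) ≤ w i) (x : ℕ → Bool) where

  -- Worst case: the at most d missing points are the first ones, where the weights are largest.
  ∑-tail≤∑-selected : ∀ L d → missing x L ≤ d → ∑[ i < L ∸ d ] w (d + i) ≤ ∑[ i < L ] (𝟙 (x i) * w i)
  ∑-tail≤∑-selected zero    d _ rewrite 0∸n≡0 d = z≤n
  ∑-tail≤∑-selected (suc L) d few with x L
  ... | true = selected-last (d ≤? L)
    where
    selected = ∑-tail≤∑-selected L d (≤-trans (m≤m+n _ 0) few)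
    selected-last : Dec (d ≤ L) →
                    ∑[ i < suc L ∸ d ] w (d + i) ≤ ∑[ i < L ] (𝟙 (x i) * w i) + (w L + 0)
    selected-last (no  d≰L) rewrite m≤n⇒m∸n≡0 (≰⇒> d≰L) = z≤n
    selected-last (yes d≤L) = begin
      ∑[ i < suc L ∸ d ] w (d + i)
        ≡⟨ cong (λ k → ∑[ i < k ] w (d + i)) (+-∸-assoc 1 d≤L) ⟩
      ∑[ i < L ∸ d ] w (d + i) + w (d + (L ∸ d))
        ≡⟨ cong (λ k → ∑[ i < L ∸ d ] w (d + i) + w k) (m+[n∸m]≡n d≤L) ⟩
      ∑[ i < L ∸ d ] w (d + i) + w L
        ≤⟨ +-mono-≤ selected (m≤m+n (w L) 0) ⟩
      ∑[ i < L ] (𝟙 (x i) * w i) + (w L + 0)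
        ∎
      where open ≤-Reasoning
  ... | false = missing-last d (subst (_≤ d) (+-comm (missing x L) 1) few)
    where
    missing-last : ∀ d → suc (missing x L) ≤ d →
                   ∑[ i < suc L ∸ d ] w (d + i) ≤ ∑[ i < L ] (𝟙 (x i) * w i) + 0
    missing-last (suc d′) (s≤s few′) = begin
      ∑[ i < L ∸ d′ ] w (suc d′ + i)  ≤⟨ ∑-mono-≤ (L ∸ d′) (λ i _ → w-antitone (d′ + i)) ⟩
      ∑[ i < L ∸ d′ ] w (d′ + i)      ≤⟨ ∑-tail≤∑-selected L d′ few′ ⟩
      ∑[ i < L ] (𝟙 (x i) * w i)      ≤⟨ m≤m+n _ 0 ⟩
      ∑[ i < L ] (𝟙 (x i) * w i) + 0  ∎
      where open ≤-Reasoning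

partners : (ℕ → Bool) → ℕ → ℕ → ℕ
partners x n a = ∑[ b < suc n ] 𝟙 (x b ∧ x (a * b))

#products : (ℕ → Bool) → ℕ → ℕ
#products x n = ∑[ a < suc n ] (𝟙 (x a) * partners x n a)

4ab≤[a+b]²-ordered : ∀ {a b} → a ≤ b → 4 * a * b ≤ (a + b) * (a + b)
4ab≤[a+b]²-ordered {a} {b} a≤b = subst (λ b → 4 * a * b ≤ (a + b) * (a + b)) (m+[n∸m]≡n a≤b)
  (≤-trans (m≤m+n _ ((b ∸ a) * (b ∸ a))) (≤-reflexive (square a (b ∸ a))))
  where
  square : ∀ a e → 4 * a * (a + e) + e * e ≡ (a + (a + e)) * (a + (a + e))
  square = solve-∀

4ab≤[a+b]² : ∀ a b → 4 * a * b ≤ (a + b) * (a + b)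
4ab≤[a+b]² a b with ≤-total a b
... | inj₁ a≤b = 4ab≤[a+b]²-ordered a≤b
... | inj₂ b≤a = subst₂ _≤_ (swap b a) (cong₂ _*_ (+-comm b a) (+-comm b a)) (4ab≤[a+b]²-ordered b≤a)
  where
  swap : ∀ b a → 4 * b * a ≡ 4 * a * b
  swap = solve-∀

n≤[1+n/a]*a : ∀ n a .{{_ : NonZero a}} → n ≤ (1 + n / a) * a
n≤[1+n/a]*a n a = begin
  n                      ≡⟨ m≡m%n+[m/n]*n n a ⟩
  n % a + n / a * a      ≤⟨ +-monoˡ-≤ (n / a * a) (<⇒≤ (m%n<n n a)) ⟩
  (1 + n / a) * a        ∎
  where open ≤-Reasoning

4bn≤[a+b]²[1+n/a] : ∀ n a b .{{_ : NonZero a}} → 4 * b * n ≤ (a + b) * (a + b) * (1 + n / a)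
4bn≤[a+b]²[1+n/a] n a b = *-cancelʳ-≤ (4 * b * n) _ a (begin
  4 * b * n * a                     ≡⟨ reorder b n a ⟩
  4 * a * b * n                     ≤⟨ *-monoˡ-≤ n (4ab≤[a+b]² a b) ⟩
  (a + b) * (a + b) * n             ≤⟨ *-monoʳ-≤ ((a + b) * (a + b)) (n≤[1+n/a]*a n a) ⟩
  (a + b) * (a + b) * ((1 + n / a) * a) ≡⟨ *-assoc ((a + b) * (a + b)) _ a ⟨
  (a + b) * (a + b) * (1 + n / a) * a ∎)
  where
  open ≤-Reasoning
  reorder : ∀ b n a → 4 * b * n * a ≡ 4 * a * b * n
  reorder = solve-∀

2∑[c∸i]+m²≡m[2c+1] : ∀ c m → m ≤ c → 2 * ∑[ i < m ] (c ∸ i) + m * m ≡ m * (2 * c + 1)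
2∑[c∸i]+m²≡m[2c+1] c zero    _   = refl
2∑[c∸i]+m²≡m[2c+1] c (suc m) m<c = begin
  2 * (∑[ i < m ] (c ∸ i) + (c ∸ m)) + suc m * suc m
    ≡⟨ expand (∑[ i < m ] (c ∸ i)) (c ∸ m) m ⟩
  (2 * ∑[ i < m ] (c ∸ i) + m * m) + (2 * (c ∸ m + m) + 1)
    ≡⟨ cong₂ (λ k l → k + (2 * l + 1)) (2∑[c∸i]+m²≡m[2c+1] c m m≤c) (m∸n+n≡m m≤c) ⟩
  m * (2 * c + 1) + (2 * c + 1)  ≡⟨ +-comm (m * (2 * c + 1)) _ ⟩
  suc m * (2 * c + 1)            ∎
  where
  open ≡-Reasoning
  m≤c = <⇒≤ m<c
  expand : ∀ s r m → 2 * (s + r) + (1 + m) * (1 + m) ≡ (2 * s + m * m) + (2 * (r + m) + 1)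
  expand = solve-∀

-- Tangent-line estimate for the harmonic sum: a = K + 1 + i is paired with b = 2K − i,
-- so that a + b = 3K + 1 is constant and ∑ b = K (3K + 1) / 2.
2nK≤[1+3K][K+∑n/a] : ∀ n K → 2 * n * K ≤ (1 + 3 * K) * (K + ∑[ i < K ] (n / suc (K + i)))
2nK≤[1+3K][K+∑n/a] n K = *-cancelˡ-≤ (2 * s) (begin
  2 * s * (2 * n * K)                    ≡⟨ reorder n K s ⟩
  4 * n * (K * s)                        ≡⟨ cong (4 * n *_) 2∑b≡Ks ⟨
  4 * n * (2 * ∑[ i < K ] b i)           ≡⟨ reorder′ n (∑[ i < K ] b i) ⟩
  2 * (4 * n * ∑[ i < K ] b i)           ≡⟨ cong (2 *_) (*-distribˡ-∑ (4 * n) K b) ⟨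
  2 * ∑[ i < K ] (4 * n * b i)           ≤⟨ *-monoʳ-≤ 2 (∑-mono-≤ K tangent) ⟩
  2 * ∑[ i < K ] (s * s * (1 + n / suc (K + i)))
    ≡⟨ cong (2 *_) (*-distribˡ-∑ (s * s) K _) ⟩
  2 * (s * s * ∑[ i < K ] (1 + n / suc (K + i)))
    ≡⟨ cong (λ k → 2 * (s * s * k)) ∑[1+n/a]≡K+D ⟩
  2 * (s * s * (K + D))                  ≡⟨ reorder″ s (K + D) ⟩
  2 * s * (s * (K + D))                  ∎)
  where
  open ≤-Reasoning
  s = 1 + 3 * K
  b : ℕ → ℕ
  b i = 2 * K ∸ i
  D = ∑[ i < K ] (n / suc (K + i))
  ∑[1+n/a]≡K+D : ∑[ i < K ] (1 + n / suc (K + i)) ≡ K + D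
  ∑[1+n/a]≡K+D = trans (∑-distrib-+ K) (cong (_+ D) (trans (∑-const K 1) (*-identityʳ K)))
  reorder : ∀ n K s → 2 * s * (2 * n * K) ≡ 4 * n * (K * s)
  reorder = solve-∀
  reorder′ : ∀ n σ → 4 * n * (2 * σ) ≡ 2 * (4 * n * σ)
  reorder′ = solve-∀
  reorder″ : ∀ s t → 2 * (s * s * t) ≡ 2 * s * (s * t)
  reorder″ = solve-∀
  tangent : ∀ i → i < K → 4 * n * b i ≤ s * s * (1 + n / suc (K + i))
  tangent i i<K = subst₂ _≤_ (reorder‴ (b i) n) (cong (λ k → k * k * (1 + n / suc (K + i))) pair-sum)
                    (4bn≤[a+b]²[1+n/a] n (suc (K + i)) (b i))
    where
    reorder‴ : ∀ b n → 4 * b * n ≡ 4 * n * b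
    reorder‴ = solve-∀
    pair-sum : suc (K + i) + b i ≡ s
    pair-sum = cong suc (trans (+-assoc K i (b i)) (cong (K +_) (m+[n∸m]≡n (≤-trans (<⇒≤ i<K) (m≤m+n K _)))))
  2∑b≡Ks : 2 * ∑[ i < K ] b i ≡ K * s
  2∑b≡Ks = +-cancelʳ-≡ (K * K) _ _ (trans (2∑[c∸i]+m²≡m[2c+1] (2 * K) K (m≤m+n K _)) (split K))
    where
    split : ∀ K → K * (2 * (2 * K) + 1) ≡ K * (1 + 3 * K) + K * K
    split = solve-∀

[1+3K][n+16K²+16K]≤16Kn : ∀ n K → 4 * K * K ≤ n → 18 ≤ K →
                          (1 + 3 * K) * (n + 16 * K * K + 16 * K) ≤ 16 * K * n
[1+3K][n+16K²+16K]≤16Kn n K 4K²≤n 18≤K =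
  subst₂ (λ K n → (1 + 3 * K) * (n + 16 * K * K + 16 * K) ≤ 16 * K * n) K≡ n≡
    (≤-trans (m≤m+n _ _) (≤-reflexive (sym (surplus f e))))
  where
  f = K ∸ 18
  e = n ∸ 4 * K * K
  K≡ : 18 + f ≡ K
  K≡ = m+[n∸m]≡n 18≤K
  n≡ : 4 * (18 + f) * (18 + f) + e ≡ n
  n≡ = trans (cong (λ k → 4 * k * k + e) K≡) (m+[n∸m]≡n 4K²≤n)
  surplus : ∀ f e → let K = 18 + f; n = 4 * K * K + e in
    16 * K * n ≡ (1 + 3 * K) * (n + 16 * K * K + 16 * K) + (4 * K * (14 + 19 * f + f * f) + (233 + 13 * f) * e)
  surplus = solve-∀

n≤8T : ∀ n K T D → D ≤ T + K * (K + suc K) → 2 * n * K ≤ (1 + 3 * K) * (K + D) →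
       4 * K * K ≤ n → 18 ≤ K → n ≤ 8 * T
n≤8T n K T D D≤ 2nK≤ 4K²≤n 18≤K = *-cancelˡ-≤ s (+-cancelʳ-≤ (s * r) _ _ (begin
  s * n + s * r          ≡⟨ *-distribˡ-+ s n r ⟨
  s * (n + r)            ≡⟨ cong (s *_) (+-assoc n _ _) ⟨
  s * (n + 16 * K * K + 16 * K) ≤⟨ [1+3K][n+16K²+16K]≤16Kn n K 4K²≤n 18≤K ⟩
  16 * K * n             ≡⟨ reorder n K ⟩
  8 * (2 * n * K)        ≤⟨ *-monoʳ-≤ 8 2nK≤ ⟩
  8 * (s * (K + D))      ≤⟨ *-monoʳ-≤ 8 (*-monoʳ-≤ s (+-monoʳ-≤ K D≤)) ⟩
  8 * (s * (K + (T + K * (K + suc K)))) ≡⟨ expand s K T ⟩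
  s * (8 * T) + s * r    ∎))
  where
  open ≤-Reasoning
  s = 1 + 3 * K
  r = 16 * K * K + 16 * K
  reorder : ∀ n K → 16 * K * n ≡ 8 * (2 * n * K)
  reorder = solve-∀
  expand : ∀ s K T → 8 * (s * (K + (T + K * (K + (1 + K))))) ≡ s * (8 * T) + s * (16 * K * K + 16 * K)
  expand = solve-∀

module _ {n K : ℕ} (x : ℕ → Bool) (few-missing : missing x (suc n) ≤ suc K) where

  n/a∸[2K+1]≤partners : ∀ a → n / suc a ∸ (K + suc K) ≤ partners x n (suc a)
  n/a∸[2K+1]≤partners a = m≤n+o⇒m∸n≤o m (K + suc K) (s≤s⁻¹ (begin
    suc m                                          ≤⟨ length≤common+missing+missing x (λ b → x (suc a * b)) (suc m) ⟩
    common + missing x (suc m) + missing (λ b → x (suc a * b)) (suc m)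
      ≤⟨ +-mono-≤ (+-mono-≤ common≤partners few-below-m) few-dilated ⟩
    partners x n (suc a) + suc K + suc K           ≡⟨ regroup (partners x n (suc a)) K ⟩
    suc (K + suc K + partners x n (suc a))         ∎))
    where
    open ≤-Reasoning
    m = n / suc a
    m≤n : m ≤ n
    m≤n = m/n≤m n (suc a)
    am≤n : suc a * m ≤ n
    am≤n = ≤-trans (≤-reflexive (*-comm (suc a) m)) (m/n*n≤m n (suc a))
    common = ∑[ b < suc m ] 𝟙 (x b ∧ x (suc a * b))
    common≤partners : common ≤ partners x n (suc a)
    common≤partners = ∑-mono-length (λ b → 𝟙 (x b ∧ x (suc a * b))) (s≤s m≤n)
    few-below-m : missing x (suc m) ≤ suc K
    few-below-m = ≤-trans (∑-mono-length (λ i → 𝟙 (not (x i))) (s≤s m≤n)) few-missing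
    few-dilated : missing (λ b → x (suc a * b)) (suc m) ≤ suc K
    few-dilated = ≤-trans (∑-dilate a m (λ j → 𝟙 (not (x j))))
                    (≤-trans (∑-mono-length (λ i → 𝟙 (not (x i))) (s≤s am≤n)) few-missing)
    regroup : ∀ P K → P + (1 + K) + (1 + K) ≡ 1 + (K + (1 + K) + P)
    regroup = solve-∀

  n≤8*#products : x 0 ≡ false → 18 ≤ K → 4 * K * K ≤ n → n ≤ 8 * #products x n
  n≤8*#products x0≡false 18≤K 4K²≤n =
    n≤8T n K (#products x n) D D≤T+Kc (2nK≤[1+3K][K+∑n/a] n K) 4K²≤n 18≤K
    where
    c = K + suc K
    -- w 0 is only a placeholder: 0 ∉ x, and w 0 = w 1 keeps w antitone.
    w : ℕ → ℕ
    w zero    = w 1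
    w (suc a) = n / suc a ∸ c
    w-antitone : ∀ a → w (suc a) ≤ w a
    w-antitone zero    = ≤-refl
    w-antitone (suc a) = ∸-monoˡ-≤ c (/-monoʳ-≤ n (n≤1+n (suc a)))
    w≤partners : ∀ a → a < suc n → 𝟙 (x a) * w a ≤ 𝟙 (x a) * partners x n a
    w≤partners zero    _ rewrite x0≡false = z≤n
    w≤partners (suc a) _ = *-monoʳ-≤ (𝟙 (x (suc a))) (n/a∸[2K+1]≤partners a)
    2K≤n : K + K ≤ n
    2K≤n = ≤-trans (≤-trans (m≤m+n (K + K) (K + K)) (≤-reflexive (double K)))
                   (≤-trans (*-monoʳ-≤ (4 * K) (≤-trans (s≤s z≤n) 18≤K)) 4K²≤n)
      where
      double : ∀ K → K + K + (K + K) ≡ 4 * K * 1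
      double = solve-∀
    selected : ∑[ i < K ] w (suc K + i) ≤ ∑[ a < suc n ] (𝟙 (x a) * w a)
    selected = begin
      ∑[ i < K ] w (suc K + i)                  ≡⟨ cong (λ k → ∑[ i < k ] w (suc K + i)) (m+n∸m≡n (suc K) K) ⟨
      ∑[ i < suc K + K ∸ suc K ] w (suc K + i)  ≤⟨ ∑-tail≤∑-selected w w-antitone x (suc K + K) (suc K) few-below-2K ⟩
      ∑[ a < suc K + K ] (𝟙 (x a) * w a)        ≤⟨ ∑-mono-length (λ a → 𝟙 (x a) * w a) (s≤s 2K≤n) ⟩
      ∑[ a < suc n ] (𝟙 (x a) * w a)            ∎
      where
      open ≤-Reasoning
      few-below-2K = ≤-trans (∑-mono-length (λ i → 𝟙 (not (x i))) (s≤s 2K≤n)) few-missing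
    D = ∑[ i < K ] (n / suc (K + i))
    D≤T+Kc : D ≤ #products x n + K * c
    D≤T+Kc = begin
      D                                     ≤⟨ ∑≤∑∸+ K c (λ i → n / suc (K + i)) ⟩
      ∑[ i < K ] w (suc K + i) + K * c      ≤⟨ +-monoˡ-≤ (K * c) selected ⟩
      ∑[ a < suc n ] (𝟙 (x a) * w a) + K * c ≤⟨ +-monoˡ-≤ (K * c) (∑-mono-≤ (suc n) w≤partners) ⟩
      #products x n + K * c                 ∎
      where open ≤-Reasoning

member : ∀ {m} → Subset m → ℕ → Bool
member []      _       = false
member (b ∷ p) zero    = b
member (b ∷ p) (suc i) = member p i

∣p∣≡count-member : ∀ {m} (p : Subset m) → ∣ p ∣ ≡ ∑[ i < m ] 𝟙 (member p i)
∣p∣≡count-member []                  = refl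
∣p∣≡count-member {suc m} (true ∷ p)  =
  trans (cong suc (∣p∣≡count-member p)) (sym (∑-head m (λ i → 𝟙 (member (true ∷ p) i))))
∣p∣≡count-member {suc m} (false ∷ p) =
  trans (∣p∣≡count-member p) (sym (∑-head m (λ i → 𝟙 (member (false ∷ p) i))))

member-toℕ⇒∈ : ∀ {m} (p : Subset m) i → member p (toℕ i) ≡ true → i ∈ p
member-toℕ⇒∈ (true ∷ p) zero    _  = here
member-toℕ⇒∈ (b ∷ p)    (suc i) eq = there (member-toℕ⇒∈ p i eq)

member⇒∃∈ : ∀ {m} (p : Subset m) k → member p k ≡ true → ∃[ c ] toℕ c ≡ k × c ∈ p
member⇒∃∈ (true ∷ p) zero    _ = zero , refl , here
member⇒∃∈ (b ∷ p)    (suc k) eq with member⇒∃∈ p k eq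
... | c , refl , c∈p = suc c , refl , there c∈p

member-0 : ∀ {m} (p : Subset m) → (∀ c → c ∈ p → 0 < toℕ c) → member p 0 ≡ false
member-0 []          _   = refl
member-0 (false ∷ p) _   = refl
member-0 (true ∷ p)  pos with () ← pos zero here

module _ {ℓ : Level} {X Y : Set} {P : Pred (X × Y) ℓ} (P? : Decidable P) where

  length-filter-map-, : ∀ x ys → length (filter P? (map (x ,_) ys)) ≡ length (filter (λ y → P? (x , y)) ys)
  length-filter-map-, x []       = refl
  length-filter-map-, x (y ∷ ys) with does (P? (x , y))
  ... | true  = cong suc (length-filter-map-, x ys)
  ... | false = length-filter-map-, x ys

  ∑≤length-filter-cartesianProduct : ∀ m (g : Fin m → X) ys (f : ℕ → ℕ) →
    (∀ i → f (toℕ i) ≤ length (filter (λ y → P? (g i , y)) ys)) →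
    ∑ m f ≤ length (filter P? (cartesianProduct (tabulate g) ys))
  ∑≤length-filter-cartesianProduct zero    g ys f f≤ = z≤n
  ∑≤length-filter-cartesianProduct (suc m) g ys f f≤ = begin
    ∑ (suc m) f                                        ≡⟨ ∑-head m f ⟩
    f 0 + ∑[ i < m ] f (suc i)
      ≤⟨ +-mono-≤ (≤-trans (f≤ zero) (≤-reflexive (sym (length-filter-map-, (g zero) ys))))
                  (∑≤length-filter-cartesianProduct m (λ i → g (suc i)) ys (λ i → f (suc i)) (λ i → f≤ (suc i))) ⟩
    length (filter P? first) + length (filter P? rest) ≡⟨ length-++ (filter P? first) ⟨
    length (filter P? first ++ filter P? rest)         ≡⟨ cong length (filter-++ P? first rest) ⟨
    length (filter P? (first ++ rest))                 ∎
    where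
    open ≤-Reasoning
    first = map (g zero ,_) ys
    rest  = cartesianProduct (tabulate (λ i → g (suc i))) ys

#products≤#solutions : ∀ {n} (A : Subset (suc n)) → #products (member A) n ≤ #solutions A
#products≤#solutions {n} A =
  ∑≤length-filter-cartesianProduct Sol? (suc n) (λ a → a) (cartesianProduct Ns Ns) _ outer
  where
  Ns = allFin (suc n)
  Sol? = λ { (a , b , c) → (a ∈? A) ×-dec ((b ∈? A) ×-dec ((c ∈? A) ×-dec (toℕ a * toℕ b ≟ toℕ c))) }
  inner : ∀ a b → member A (toℕ a) ≡ true →
          𝟙 (member A (toℕ b) ∧ member A (toℕ a * toℕ b)) ≤ length (filter (λ c → Sol? (a , b , c)) Ns)
  inner a b a∈A with member A (toℕ b) in b∈A | member A (toℕ a * toℕ b) in ab∈A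
  ... | false | _    = z≤n
  ... | true  | false = z≤n
  ... | true  | true with member⇒∃∈ A _ ab∈A
  ...   | c , c≡ab , c∈A = filter-some (λ c → Sol? (a , b , c))
    (Any.map (λ { refl → member-toℕ⇒∈ A a a∈A , member-toℕ⇒∈ A b b∈A , c∈A , sym c≡ab }) (∈-allFin c))
  outer : ∀ a → 𝟙 (member A (toℕ a)) * partners (member A) n (toℕ a)
                ≤ length (filter (λ bc → Sol? (a , bc)) (cartesianProduct Ns Ns))
  outer a with member A (toℕ a) in a∈A
  ... | false = z≤n
  ... | true  = ≤-trans (≤-reflexive (+-identityʳ _))
    (∑≤length-filter-cartesianProduct (λ bc → Sol? (a , bc)) (suc n) (λ b → b) Ns _ (λ b → inner a b a∈A))

missing-member≤ : ∀ {n} (A : Subset (suc n)) → missing (member A) (suc n) ≤ suc (n ∸ ∣ A ∣)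
missing-member≤ {n} A = +-cancelˡ-≤ ∣ A ∣ _ _ (begin
  ∣ A ∣ + missing (member A) (suc n)                  ≡⟨ cong (_+ missing (member A) (suc n)) (∣p∣≡count-member A) ⟩
  ∑[ i < suc n ] 𝟙 (member A i) + missing (member A) (suc n) ≡⟨ count+missing≡length (member A) (suc n) ⟩
  suc n                                               ≤⟨ s≤s (m≤n+m∸n n ∣ A ∣) ⟩
  suc (∣ A ∣ + (n ∸ ∣ A ∣))                           ≡⟨ +-suc ∣ A ∣ _ ⟨
  ∣ A ∣ + suc (n ∸ ∣ A ∣)                             ∎)
  where open ≤-Reasoning

4[k⊔18]²≤n : ∀ n k → 4 * 18 * 18 ≤ n → 4 * k ^ 2 ≤ n → 4 * (k ⊔ 18) * (k ⊔ 18) ≤ n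
4[k⊔18]²≤n n k 4*18²≤n 4k²≤n with ⊔-sel k 18
... | inj₁ k⊔18≡k  = subst (λ K → 4 * K * K ≤ n) (sym k⊔18≡k) (subst (_≤ n) (square k) 4k²≤n)
  where
  square : ∀ k → 4 * k ^ 2 ≡ 4 * k * k
  square k = trans (cong (λ t → 4 * (k * t)) (*-identityʳ k)) (sym (*-assoc 4 k k))
... | inj₂ k⊔18≡18 = subst (λ K → 4 * K * K ≤ n) (sym k⊔18≡18) 4*18²≤n

lemma2p1 : ∃[ N ] ((n : ℕ) → N ≤ n → (A : Subset (suc n)) →
               (∀ i → i ∈ A → 2 ≤ toℕ i) →
               4 * (n ∸ ∣ A ∣) ^ 2 ≤ n →
               n ≤ 8 * #solutions A)
lemma2p1 = 4 * 18 * 18 , λ n N≤n A A≥2 4k²≤n →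
  let k = n ∸ ∣ A ∣ in
  ≤-trans (n≤8*#products (member A) (≤-trans (missing-member≤ A) (s≤s (m≤m⊔n k 18)))
             (member-0 A (λ c c∈A → ≤-trans (s≤s z≤n) (A≥2 c c∈A)))
             (m≤n⊔m k 18) (4[k⊔18]²≤n n k N≤n 4k²≤n))
          (*-monoʳ-≤ 8 (#products≤#solutions A))
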